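{- Let $v, w$ be distinct binary words of the same length $n$. Then $\Omega^*_{v,w}(v) = \Omega^*_{v,w}(w)$ if and only if for every $f \in F(v,w)$, neither $fv$ nor $fw$ belongs to $\Omega_{v,w}$.
   Context: Juxtaposition denotes concatenation of words. $\Omega_{v,w}(v)$ is the set of finite binary words $u$ that end with $v$, in which $v$ occurs as a contiguous subword only as the suffix, and in which $w$ does not occur as a contiguous subword; $\Omega_{v,w}(w)$ is defined symmetrically, and $\Omega_{v,w} = \Omega_{v,w}(v)\cup\Omega_{v,w}(w)$. $\Omega^*_{v,w}(v) = \{x : xv \in \Omega_{v,w}(v)\}$, $\Omega^*_{v,w}(w) = \{x : xw \in \Omega_{v,w}(w)\}$. For words $x = x_1\cdots x_m$ and $y = y_1 \cdots y_\ell$, $D(x,y)$ is the set of nonempty prefixes $x_1\cdots x_{m-k}$ of $x$ (with $1 \le k \le \min(m,\ell)$, $k<m$) such that $y_1\cdots y_k = x_{m-k+1}\cdots x_m$. Set $F(v,w) = D(v,v)\cup D(w,w)\cup D(w,v)\cup D(v,w)$. -}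

module Defs where

open import Data.Bool using (Bool)
open import Data.List using (List; []; _++_; length; take; drop)
open import Data.Nat using (ℕ; _≤_; _<_; _∸_)
open import Data.Product using (Σ; _×_; ∃)
open import Data.Sum using (_⊎_)
open import Relation.Nullary using (¬_)
open import Relation.Binary.PropositionalEquality using (_≡_)

Word : Set
Word = List Bool

Infix : Word → Word → Set
Infix u x = Σ Word λ a → Σ Word λ b → a ++ u ++ b ≡ x

OmegaAt : Word → Word → Word → Set
OmegaAt v w u =
  (Σ Word λ x → u ≡ x ++ v)
  × (∀ a b → a ++ v ++ b ≡ u → b ≡ [])
  × ¬ Infix w u

Ωv : Word → Word → Word → Set
Ωv v w = OmegaAt v w

Ωw : Word → Word → Word → Set
Ωw v w = OmegaAt w v

Ω : Word → Word → Word → Set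
Ω v w u = Ωv v w u ⊎ Ωw v w u

Ω*v : Word → Word → Word → Set
Ω*v v w x = Ωv v w (x ++ v)

Ω*w : Word → Word → Word → Set
Ω*w v w x = Ωw v w (x ++ w)

D : Word → Word → Word → Set
D x y p = Σ ℕ λ k →
  (1 ≤ k) × (k ≤ length y) × (k < length x)
  × (p ≡ take (length x ∸ k) x)
  × (take k y ≡ drop (length x ∸ k) x)

F : Word → Word → Word → Set
F v w f = D v v f ⊎ D w w f ⊎ D w v f ⊎ D v w f

{-# OPTIONS --safe #-}
module Submission where

-- Backward direction: let x v ∈ Ω(v). An occurrence of v or w in x w other than the final w either
-- lies inside x, and so already occurs in x v with a nonempty tail, or straddles the boundary: then
-- x = a m with m ∈ D(v,w) ∪ D(w,w), and m v, a suffix of x v ending in v, lies in Ω(v), which the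
-- condition on F forbids. Forward direction: an f ∈ F with f v ∈ Ω(v) would also have f w ∈ Ω(w),
-- but the overlap defining f places v or w at a forbidden position of f v or f w.

open import Defs
open import Level using (Level)
open import Data.Empty using (⊥-elim)
open import Data.List using (List; []; _∷_; length; _++_; take; drop)
open import Data.List.Properties
  using (∷-injective; length-++; length-++-≤ˡ; length-++-≤ʳ; take++drop≡id; ++-assoc; ++-identityʳ; ++-conicalʳ)
open import Data.Nat using (ℕ; zero; suc; _+_; _∸_; _≤_; _<_; z≤n; s≤s)
open import Data.Nat.Properties
  using (+-commutativeSemigroup; +-cancelˡ-≡; +-identityʳ; m+n≡0⇒m≡0; m+n≡0⇒n≡0; m+n∸n≡m; ≤-refl; ≤-reflexive; ≤-trans)
open import Algebra.Properties.CommutativeSemigroup +-commutativeSemigroup using (x∙yz≈y∙xz)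
open import Data.Product using (_×_; _,_; proj₁; proj₂; ∃-syntax)
open import Data.Sum using (_⊎_; inj₁; inj₂; [_,_])
open import Function using (_∘_)
open import Function.Bundles using (_⇔_; mk⇔; Equivalence)
open import Relation.Nullary using (¬_)
open import Relation.Binary.PropositionalEquality
  using (_≡_; _≢_; refl; sym; trans; cong; cong₂; subst; module ≡-Reasoning)
open ≡-Reasoning

module _ {ℓ : Level} {A : Set ℓ} where

  length≡0⇒≡[] : {xs : List A} → length xs ≡ 0 → xs ≡ []
  length≡0⇒≡[] {[]}    _  = refl
  length≡0⇒≡[] {_ ∷ _} ()

  drop-≢[] : ∀ {k} (ys : List A) → k < length ys → drop k ys ≢ []
  drop-≢[] {zero}  (_ ∷ _)  _         ()
  drop-≢[] {suc k} (_ ∷ ys) (s≤s k<n) = drop-≢[] ys k<n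

  take-length-++ : ∀ (xs ys : List A) → take (length xs) (xs ++ ys) ≡ xs
  take-length-++ []       ys = refl
  take-length-++ (x ∷ xs) ys = cong (x ∷_) (take-length-++ xs ys)

  drop-length-++ : ∀ (xs ys : List A) → drop (length xs) (xs ++ ys) ≡ ys
  drop-length-++ []       ys = refl
  drop-length-++ (x ∷ xs) ys = drop-length-++ xs ys

  infix-of-same-length⇒[] : ∀ (m u b : List A) → length (m ++ u ++ b) ≡ length u → m ≡ [] × b ≡ []
  infix-of-same-length⇒[] m u b eq =
    length≡0⇒≡[] (m+n≡0⇒m≡0 (length m) margins≡0) , length≡0⇒≡[] (m+n≡0⇒n≡0 (length m) margins≡0)
    where
    margins≡0 : length m + length b ≡ 0
    margins≡0 = +-cancelˡ-≡ (length u) _ _ (begin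
      length u + (length m + length b) ≡⟨ x∙yz≈y∙xz (length u) (length m) (length b) ⟩
      length m + (length u + length b) ≡⟨ cong (length m +_) (length-++ u) ⟨
      length m + length (u ++ b)       ≡⟨ length-++ m ⟨
      length (m ++ u ++ b)             ≡⟨ eq ⟩
      length u                         ≡⟨ +-identityʳ (length u) ⟨
      length u + 0                     ∎)

  ++-levi : ∀ (a c x d : List A) → a ++ c ≡ x ++ d →
    (∃[ m ] x ≡ a ++ m × c ≡ m ++ d) ⊎ (∃[ m ] m ≢ [] × a ≡ x ++ m × d ≡ m ++ c)
  ++-levi []       c x        d eq = inj₁ (x , refl , eq)
  ++-levi (a ∷ as) c []       d eq = inj₂ (a ∷ as , (λ ()) , refl , sym eq)
  ++-levi (a ∷ as) c (y ∷ ys) d eq with ∷-injective eq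
  ... | refl , eq′ with ++-levi as c ys d eq′
  ...   | inj₁ (m , x≡am , c≡md)        = inj₁ (m , cong (a ∷_) x≡am , c≡md)
  ...   | inj₂ (m , m≢[] , a≡xm , d≡mc) = inj₂ (m , m≢[] , cong (a ∷_) a≡xm , d≡mc)

  ++-occurrence-cases : ∀ (a u b x y : List A) → a ++ u ++ b ≡ x ++ y →
      (∃[ m ] x ≡ a ++ u ++ m)
    ⊎ (∃[ m ] ∃[ m′ ] m ≢ [] × m′ ≢ [] × x ≡ a ++ m × u ≡ m ++ m′ × y ≡ m′ ++ b)
    ⊎ (∃[ m ] y ≡ m ++ u ++ b)
  ++-occurrence-cases a u b x y eq with ++-levi x y a (u ++ b) (sym eq)
  ... | inj₁ (m , _ , y≡mub) = inj₂ (inj₂ (m , y≡mub))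
  ... | inj₂ (m , m≢[] , x≡am , ub≡my) with ++-levi u b m y ub≡my
  ...   | inj₁ (m′ , m≡um′ , _) = inj₁ (m′ , trans x≡am (cong (a ++_) m≡um′))
  ...   | inj₂ (m′ , m′≢[] , u≡mm′ , y≡m′b) = inj₂ (inj₁ (m , m′ , m≢[] , m′≢[] , x≡am , u≡mm′ , y≡m′b))

D-intro : ∀ {m m′ : Word} b → m ≢ [] → m′ ≢ [] → D (m ++ m′) (m′ ++ b) m
D-intro {[]}         {_}       _ m≢[] _     = ⊥-elim (m≢[] refl)
D-intro {_}          {[]}      _ _    m′≢[] = ⊥-elim (m′≢[] refl)
D-intro {m@(_ ∷ m₀)} {m′@(_ ∷ _)} b _ _ =
  length m′ , s≤s z≤n , length-++-≤ˡ m′ , s≤s (length-++-≤ʳ m′ {m₀}) , m≡take , take≡drop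
  where
  j≡|m| : length (m ++ m′) ∸ length m′ ≡ length m
  j≡|m| = trans (cong (_∸ length m′) (length-++ m)) (m+n∸n≡m (length m) (length m′))
  m≡take : m ≡ take (length (m ++ m′) ∸ length m′) (m ++ m′)
  m≡take = trans (sym (take-length-++ m m′)) (cong (λ j → take j (m ++ m′)) (sym j≡|m|))
  take≡drop : take (length m′) (m′ ++ b) ≡ drop (length (m ++ m′) ∸ length m′) (m ++ m′)
  take≡drop = trans (take-length-++ m′ b)
    (trans (sym (drop-length-++ m m′)) (cong (λ j → drop j (m ++ m′)) (sym j≡|m|)))

D-overlap : ∀ {x y p} → D x y p → length x ≤ length y → ∃[ r ] r ≢ [] × x ++ r ≡ p ++ y
D-overlap {x} {y} {p} (k , _ , _ , k<|x| , p≡take , take≡drop) |x|≤|y| =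
  drop k y , drop-≢[] y (≤-trans k<|x| |x|≤|y|) , (begin
    x ++ drop k y                           ≡⟨ cong (_++ drop k y) (take++drop≡id j x) ⟨
    (take j x ++ drop j x) ++ drop k y      ≡⟨ cong (λ s → (take j x ++ s) ++ drop k y) take≡drop ⟨
    (take j x ++ take k y) ++ drop k y      ≡⟨ ++-assoc (take j x) (take k y) (drop k y) ⟩
    take j x ++ (take k y ++ drop k y)      ≡⟨ cong₂ _++_ (sym p≡take) (take++drop≡id k y) ⟩
    p ++ y                                  ∎)
  where
  j = length x ∸ k

¬OmegaAt-++-forbidden : ∀ v w f → ¬ OmegaAt v w (f ++ w)
¬OmegaAt-++-forbidden v w f (_ , _ , w∉fw) = w∉fw (f , [] , cong (f ++_) (++-identityʳ w))

OmegaAt-suffix : ∀ {v w} a m → OmegaAt v w ((a ++ m) ++ v) → OmegaAt v w (m ++ v)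
OmegaAt-suffix {v} {w} a m (_ , v-final , w∉amv) =
  (m , refl) ,
  (λ a′ b eq → v-final (a ++ a′) b (shift v eq)) ,
  (λ (a′ , b , eq) → w∉amv (a ++ a′ , b , shift w eq))
  where
  shift : ∀ {a′} u {b} → a′ ++ u ++ b ≡ m ++ v → (a ++ a′) ++ u ++ b ≡ (a ++ m) ++ v
  shift {a′} u {b} eq = begin
    (a ++ a′) ++ u ++ b ≡⟨ ++-assoc a a′ (u ++ b) ⟩
    a ++ a′ ++ u ++ b   ≡⟨ cong (a ++_) eq ⟩
    a ++ m ++ v         ≡⟨ ++-assoc a m v ⟨
    (a ++ m) ++ v       ∎

F⇒¬Ω*v×Ω*w : ∀ {v w f} → length v ≡ length w → F v w f → ¬ (Ω*v v w f × Ω*w v w f)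
F⇒¬Ω*v×Ω*w _ (inj₁ d) ((_ , v-final , _) , _) =
  let r , r≢[] , eq = D-overlap d ≤-refl in r≢[] (v-final [] r eq)
F⇒¬Ω*v×Ω*w _ (inj₂ (inj₁ d)) (_ , (_ , w-final , _)) =
  let r , r≢[] , eq = D-overlap d ≤-refl in r≢[] (w-final [] r eq)
F⇒¬Ω*v×Ω*w |v|≡|w| (inj₂ (inj₂ (inj₁ d))) ((_ , _ , w∉fv) , _) =
  let r , _ , eq = D-overlap d (≤-reflexive (sym |v|≡|w|)) in w∉fv ([] , r , eq)
F⇒¬Ω*v×Ω*w |v|≡|w| (inj₂ (inj₂ (inj₂ d))) (_ , (_ , _ , v∉fw)) =
  let r , _ , eq = D-overlap d (≤-reflexive |v|≡|w|) in v∉fw ([] , r , eq)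

module _ {v w : Word} (|v|≡|w| : length v ≡ length w) (v≢w : v ≢ w)
         (Dvw-free : ∀ m → D v w m → ¬ Ω*v v w m)
         (Dww-free : ∀ m → D w w m → ¬ Ω*v v w m)
         {x : Word} (x∈Ω*v : Ω*v v w x) where

  private
    v≢[] : v ≢ []
    v≢[] v≡[] = v≢w (trans v≡[] (sym (length≡0⇒≡[] (trans (sym |v|≡|w|) (cong length v≡[])))))

    occurrence-in-xw : ∀ {u} → length u ≡ length w
      → (∀ a r → a ++ u ++ r ≡ x ++ v → r ≡ [])
      → (∀ m → D u w m → ¬ Ω*v v w m)
      → ∀ a b → a ++ u ++ b ≡ x ++ w → u ≡ w × b ≡ []
    occurrence-in-xw {u} _ u-final _ a b eq with ++-occurrence-cases a u b x w eq
    ... | inj₁ (m , x≡aum) = ⊥-elim (v≢[] (++-conicalʳ m v (u-final a (m ++ v) (begin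
          a ++ u ++ m ++ v   ≡⟨ cong (a ++_) (++-assoc u m v) ⟨
          a ++ (u ++ m) ++ v ≡⟨ ++-assoc a (u ++ m) v ⟨
          (a ++ u ++ m) ++ v ≡⟨ cong (_++ v) x≡aum ⟨
          x ++ v             ∎))))
    occurrence-in-xw _ _ Duw-free a b _ | inj₂ (inj₁ (m , m′ , m≢[] , m′≢[] , x≡am , refl , w≡m′b)) =
      ⊥-elim (Duw-free m (subst (λ y → D (m ++ m′) y m) (sym w≡m′b) (D-intro b m≢[] m′≢[]))
                         (OmegaAt-suffix a m (subst (λ s → Ω*v v w s) x≡am x∈Ω*v)))
    occurrence-in-xw {u} |u|≡|w| _ _ a b _ | inj₂ (inj₂ (m , w≡mub))
      with infix-of-same-length⇒[] m u b (trans (cong length (sym w≡mub)) (sym |u|≡|w|))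
    ... | refl , refl = sym (trans w≡mub (++-identityʳ u)) , refl

  Ω*v⇒Ω*w : Ω*w v w x
  Ω*v⇒Ω*w =
    (x , refl) ,
    (λ a b eq → proj₂ (occurrence-in-xw refl w-absent Dww-free a b eq)) ,
    (λ (a , b , eq) → v≢w (proj₁ (occurrence-in-xw |v|≡|w| v-final Dvw-free a b eq)))
    where
    v-final : ∀ a r → a ++ v ++ r ≡ x ++ v → r ≡ []
    v-final = proj₁ (proj₂ x∈Ω*v)
    w-absent : ∀ a r → a ++ w ++ r ≡ x ++ v → r ≡ []
    w-absent a r eq = ⊥-elim (proj₂ (proj₂ x∈Ω*v) (a , r , eq))

lemma5p2 : (n : ℕ) (v w : Word) → length v ≡ n → length w ≡ n → v ≢ w →
    ((∀ x → Ω*v v w x ⇔ Ω*w v w x)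
      ⇔ (∀ f → F v w f → ¬ Ω v w (f ++ v) × ¬ Ω v w (f ++ w)))
lemma5p2 n v w |v|≡n |w|≡n v≢w = mk⇔ F-free Ω*-agree
  where
  |v|≡|w| : length v ≡ length w
  |v|≡|w| = trans |v|≡n (sym |w|≡n)

  F-free : (∀ x → Ω*v v w x ⇔ Ω*w v w x) → ∀ f → F v w f → ¬ Ω v w (f ++ v) × ¬ Ω v w (f ++ w)
  F-free Ω*v⇔Ω*w f f∈F =
    [ (λ fv∈Ωv → F⇒¬Ω*v×Ω*w |v|≡|w| f∈F (fv∈Ωv , Equivalence.to (Ω*v⇔Ω*w f) fv∈Ωv))
    , ¬OmegaAt-++-forbidden w v f ] ,
    [ ¬OmegaAt-++-forbidden v w f
    , (λ fw∈Ωw → F⇒¬Ω*v×Ω*w |v|≡|w| f∈F (Equivalence.from (Ω*v⇔Ω*w f) fw∈Ωw , fw∈Ωw)) ]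

  Ω*-agree : (∀ f → F v w f → ¬ Ω v w (f ++ v) × ¬ Ω v w (f ++ w)) → ∀ x → Ω*v v w x ⇔ Ω*w v w x
  -- Ω*w v w and Ω*v w v coincide by definition, so Ω*v⇒Ω*w with v, w swapped is the converse.
  Ω*-agree F-clean x = mk⇔
    (Ω*v⇒Ω*w |v|≡|w| v≢w
      (λ m d → proj₁ (F-clean m (inj₂ (inj₂ (inj₂ d)))) ∘ inj₁)
      (λ m d → proj₁ (F-clean m (inj₂ (inj₁ d))) ∘ inj₁))
    (Ω*v⇒Ω*w (sym |v|≡|w|) (v≢w ∘ sym)
      (λ m d → proj₂ (F-clean m (inj₂ (inj₂ (inj₁ d)))) ∘ inj₂)
      (λ m d → proj₂ (F-clean m (inj₁ d)) ∘ inj₂))
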